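{- Let $p$ be a prime and $\varphi$ the ring endomorphism of $\mathbf{Z}_p[[X]]$ given by $\varphi(f)(X)=f((1+X)^p-1)$. The map $f(X)\mapsto\varphi^2(f(X))/f(X)$ from $1+X\mathbf{Z}_p[[X]]$ to itself is bijective. -}

module Defs where

open import Data.Nat as ℕ using (ℕ; zero; suc; _∸_)
open import Data.Nat.Divisibility using (_∣_)
open import Data.Integer as ℤ using (ℤ; +_; ∣_∣)
open import Data.Product using (_×_)

-- p-adic integers Z_p as the inverse limit lim Z/p^n, represented by
-- (raw) sequences of integer lifts x n of the component in Z/p^n.

Raw : Set
Raw = ℕ → ℤ

_≡[mod_]_ : ℤ → ℕ → ℤ → Set
a ≡[mod m ] b = m ∣ ∣ a ℤ.- b ∣

IsZp : ℕ → Raw → Set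
IsZp p x = ∀ n → x (suc n) ≡[mod p ℕ.^ n ] x n

_≈[_]_ : Raw → ℕ → Raw → Set
x ≈[ p ] y = ∀ n → x n ≡[mod p ℕ.^ n ] y n

_+ₚ_ : Raw → Raw → Raw
(x +ₚ y) n = x n ℤ.+ y n

_*ₚ_ : Raw → Raw → Raw
(x *ₚ y) n = x n ℤ.* y n

-ₚ_ : Raw → Raw
(-ₚ x) n = ℤ.- x n

ι : ℤ → Raw
ι a n = a

Series : Set
Series = ℕ → Raw

IsSeries : ℕ → Series → Set
IsSeries p f = ∀ k → IsZp p (f k)

_≋[_]_ : Series → ℕ → Series → Set
f ≋[ p ] g = ∀ k → f k ≈[ p ] g k

sumTo : ℕ → (ℕ → Raw) → Raw
sumTo zero    a = ι (+ 0)
sumTo (suc n) a = sumTo n a +ₚ a n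

const : Raw → Series
const c zero    = c
const c (suc k) = ι (+ 0)

oneS : Series
oneS = const (ι (+ 1))

_+S_ : Series → Series → Series
(f +S g) k = f k +ₚ g k

-S_ : Series → Series
(-S f) k = -ₚ f k

_-S_ : Series → Series → Series
f -S g = f +S (-S g)

_*S_ : Series → Series → Series
(f *S g) n = sumTo (suc n) (λ k → f k *ₚ g (n ∸ k))

_^S_ : Series → ℕ → Series
f ^S zero    = oneS
f ^S suc k   = (f ^S k) *S f

-- composition f(g(X)), for g with zero constant term:
-- [X^n] f(g) = Σ_{k ≤ n} f_k [X^n] g^k
compose : Series → Series → Series
compose f g n = sumTo (suc n) (λ k → f k *ₚ (g ^S k) n)

Xs : Series
Xs zero          = ι (+ 0)
Xs (suc zero)    = ι (+ 1)
Xs (suc (suc k)) = ι (+ 0)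

-- multiplicative inverse of a series with constant term 1:
-- 1/f = Σ_k (1 - f)^k
inv : Series → Series
inv f = compose (λ _ → ι (+ 1)) (oneS -S f)

φ : ℕ → Series → Series
φ p f = compose f (((oneS +S Xs) ^S p) -S oneS)

In1+XZp[[X]] : ℕ → Series → Set
In1+XZp[[X]] p f = IsSeries p f × (f 0 ≈[ p ] ι (+ 1))

Ψ : ℕ → Series → Series
Ψ p f = φ p (φ p f) *S inv f

{-# OPTIONS --safe #-}

-- Work modulo p^m, one coefficient at a time. For k ≥ 1 the X^k-coefficient of Ψ(f) = φ²(f)/f is
-- (p^{2k} - 1)·f_k plus a function of f_0, …, f_{k-1}: substituting (1+X)^p - 1 = pX + … multiplies
-- the k-th coefficient by p^k modulo lower ones, and inversion negates it. As p^{2k} - 1 is a unit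
-- modulo p^m, this triangular system determines f from Ψ(f), and can be solved for f given any g;
-- by the same uniqueness the solutions modulo the various p^m are compatible.

module Submission where

open import Defs
open import Data.Nat as ℕ using (ℕ; zero; suc; _∸_; _<_; _≤_; s≤s; z≤n)
import Data.Nat.Properties as ℕP
open import Data.Nat.Divisibility using (divides; ∣-trans)
open import Data.Nat.Primality using (Prime)
open import Data.Integer as ℤ using (ℤ; +_; -_; _+_; _*_; _-_; _^_)
import Data.Integer.Properties as ℤP
import Data.Integer.Divisibility.Signed as Signed
open import Data.Integer.Tactic.RingSolver using (solve-∀)
open import Data.Product using (_×_; _,_; proj₁; proj₂; ∃-syntax)
open import Data.Sum using (inj₁; inj₂; [_,_]′)
open import Data.Empty using (⊥-elim)
open import Function using (_∘_)
open import Relation.Binary.Bundles using (Setoid)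
import Relation.Binary.Reasoning.Setoid as SetoidReasoning
open import Relation.Binary.PropositionalEquality
  using (_≡_; _≢_; refl; sym; trans; cong; cong₂; module ≡-Reasoning)
open import Relation.Nullary using (yes; no)

module Congruence (m : ℤ) where

  infix 4 _≈_
  record _≈_ (a b : ℤ) : Set where
    constructor _,_
    field
      quotient : ℤ
      equation : a ≡ b + quotient * m

  ≡⇒≈ : ∀ {a b} → a ≡ b → a ≈ b
  ≡⇒≈ {a} refl = + 0 , sym (trans (cong (λ x → a + x) (ℤP.*-zeroˡ m)) (ℤP.+-identityʳ a))

  ≈-refl : ∀ {a} → a ≈ a
  ≈-refl = ≡⇒≈ refl

  ≈-sym : ∀ {a b} → a ≈ b → b ≈ a
  ≈-sym {b = b} (q , refl) = - q , identity b q m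
    where
    identity : ∀ b q m → b ≡ b + q * m + - q * m
    identity = solve-∀

  ≈-trans : ∀ {a b c} → a ≈ b → b ≈ c → a ≈ c
  ≈-trans {c = c} (q , refl) (r , refl) = r + q , identity c r q m
    where
    identity : ∀ c r q m → c + r * m + q * m ≡ c + (r + q) * m
    identity = solve-∀

  +-cong : ∀ {a b c d} → a ≈ b → c ≈ d → a + c ≈ b + d
  +-cong {b = b} {d = d} (q , refl) (r , refl) = q + r , identity b d q r m
    where
    identity : ∀ b d q r m → b + q * m + (d + r * m) ≡ b + d + (q + r) * m
    identity = solve-∀

  *-cong : ∀ {a b c d} → a ≈ b → c ≈ d → a * c ≈ b * d
  *-cong {b = b} {d = d} (q , refl) (r , refl) = q * d + b * r + q * r * m , identity b d q r m
    where
    identity : ∀ b d q r m → (b + q * m) * (d + r * m) ≡ b * d + (q * d + b * r + q * r * m) * m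
    identity = solve-∀

  -‿cong : ∀ {a b} → a ≈ b → - a ≈ - b
  -‿cong {b = b} (q , refl) = - q , identity b q m
    where
    identity : ∀ b q m → - (b + q * m) ≡ - b + - q * m
    identity = solve-∀

  ≈-setoid : Setoid _ _
  ≈-setoid = record
    { Carrier = ℤ
    ; _≈_ = _≈_
    ; isEquivalence = record { refl = ≈-refl ; sym = ≈-sym ; trans = ≈-trans }
    }

  module ≈-Reasoning = SetoidReasoning ≈-setoid

  x≈y+d⇒x-y≈d : ∀ {x y d} → x ≈ y + d → x - y ≈ d
  x≈y+d⇒x-y≈d {y = y} {d} h = ≈-trans (+-cong h ≈-refl) (≡⇒≈ (identity y d))
    where
    identity : ∀ y d → y + d - y ≡ d
    identity = solve-∀

  x≈y⇒x-y≈0 : ∀ {x y} → x ≈ y → x - y ≈ + 0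
  x≈y⇒x-y≈0 {y = y} h = ≈-trans (+-cong h ≈-refl) (≡⇒≈ (ℤP.+-inverseʳ y))

  x-y≈0⇒x≈y : ∀ {x y} → x - y ≈ + 0 → x ≈ y
  x-y≈0⇒x≈y {x} {y} h = begin
    x              ≡⟨ identity x y ⟩
    y + (x - y)    ≈⟨ +-cong (≈-refl {y}) h ⟩
    y + + 0        ≡⟨ ℤP.+-identityʳ y ⟩
    y              ∎
    where
    open ≈-Reasoning
    identity : ∀ x y → x ≡ y + (x - y)
    identity = solve-∀

  unit-cancel : ∀ {c u t} → c * u ≈ + 1 → c * t ≈ + 0 → t ≈ + 0
  unit-cancel {c} {u} {t} cu≈1 ct≈0 = begin
    t              ≡⟨ sym (ℤP.*-identityˡ t) ⟩
    + 1 * t        ≈⟨ *-cong (≈-sym cu≈1) ≈-refl ⟩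
    (c * u) * t    ≡⟨ identity c u t ⟩
    (c * t) * u    ≈⟨ *-cong ct≈0 ≈-refl ⟩
    + 0 * u        ≡⟨ ℤP.*-zeroˡ u ⟩
    + 0            ∎
    where
    open ≈-Reasoning
    identity : ∀ c u t → (c * u) * t ≡ (c * t) * u
    identity = solve-∀

  unit-correction : ∀ {c u x y} → c * u ≈ + 1 → x + c * (u * (y - x)) ≈ y
  unit-correction {c} {u} {x} {y} cu≈1 = begin
    x + c * (u * (y - x))   ≡⟨ identity₁ c u x y ⟩
    x + (c * u) * (y - x)   ≈⟨ +-cong (≈-refl {x}) (*-cong cu≈1 (≈-refl {y - x})) ⟩
    x + + 1 * (y - x)       ≡⟨ identity₂ x y ⟩
    y                       ∎
    where
    open ≈-Reasoning
    identity₁ : ∀ c u x y → x + c * (u * (y - x)) ≡ x + (c * u) * (y - x)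
    identity₁ = solve-∀
    identity₂ : ∀ x y → x + + 1 * (y - x) ≡ y
    identity₂ = solve-∀

≈⇒≡[mod] : ∀ {M a b} → Congruence._≈_ (+ M) a b → a ≡[mod M ] b
≈⇒≡[mod] {M} {b = b} (q Congruence., refl) =
  divides ℤ.∣ q ∣ (trans (cong ℤ.∣_∣ (identity b q (+ M))) (ℤP.abs-* q (+ M)))
  where
  identity : ∀ b q m → b + q * m - b ≡ q * m
  identity = solve-∀

≡[mod]⇒≈ : ∀ {M a b} → a ≡[mod M ] b → Congruence._≈_ (+ M) a b
≡[mod]⇒≈ {M} {a} {b} h with Signed.∣ᵤ⇒∣ {+ M} {a - b} h
... | Signed.divides q eq = q Congruence., trans (identity a b) (cong (λ x → b + x) eq)
  where
  identity : ∀ a b → a ≡ b + (a - b)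
  identity = solve-∀

≈-mod-suc : ∀ p m {a b} → Congruence._≈_ (+ (p ℕ.^ suc m)) a b → Congruence._≈_ (+ (p ℕ.^ m)) a b
≈-mod-suc p m h = ≡[mod]⇒≈ (∣-trans (divides p refl) (≈⇒≡[mod] h))

sumTo-unfoldˡ : ∀ n (a : ℕ → Raw) l → sumTo (suc n) a l ≡ a 0 l + sumTo n (a ∘ suc) l
sumTo-unfoldˡ zero    a l = trans (ℤP.+-identityˡ (a 0 l)) (sym (ℤP.+-identityʳ (a 0 l)))
sumTo-unfoldˡ (suc n) a l =
  trans (cong (_+ a (suc n) l) (sumTo-unfoldˡ n a l)) (ℤP.+-assoc (a 0 l) _ (a (suc n) l))

sumTo-vanishing : ∀ n (a : ℕ → Raw) l → (∀ i → i < n → a i l ≡ + 0) → sumTo n a l ≡ + 0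
sumTo-vanishing zero    a l _ = refl
sumTo-vanishing (suc n) a l a≡0 =
  cong₂ _+_ (sumTo-vanishing n a l (λ i i<n → a≡0 i (ℕP.m<n⇒m<1+n i<n))) (a≡0 n ℕP.≤-refl)

*S-coeff₀ : ∀ a b l → (a *S b) 0 l ≡ a 0 l * b 0 l
*S-coeff₀ a b l = ℤP.+-identityˡ _

*S-coeff-last : ∀ n a b l → (a *S b) n l ≡ sumTo n (λ i → a i *ₚ b (n ∸ i)) l + a n l * b 0 l
*S-coeff-last n a b l = cong (λ i → sumTo n (λ k → a k *ₚ b (n ∸ k)) l + a n l * b i l) (ℕP.n∸n≡0 n)

*S-coeff-suc : ∀ n a b l →
  (a *S b) (suc n) l ≡ a 0 l * b (suc n) l + sumTo n (λ i → a (suc i) *ₚ b (n ∸ i)) l + a (suc n) l * b 0 l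
*S-coeff-suc n a b l =
  trans (*S-coeff-last (suc n) a b l)
        (cong (_+ a (suc n) l * b 0 l) (sumTo-unfoldˡ n (λ i → a i *ₚ b (suc n ∸ i)) l))

*S-vanishing : ∀ s (a b : Series) l → (∀ j → j < s → a j l ≡ + 0) → b 0 l ≡ + 0 →
  ∀ j → j ≤ s → (a *S b) j l ≡ + 0
*S-vanishing s a b l a≡0 b₀≡0 j j≤s = begin
  (a *S b) j l                                          ≡⟨ *S-coeff-last j a b l ⟩
  sumTo j (λ i → a i *ₚ b (j ∸ i)) l + a j l * b 0 l    ≡⟨ cong₂ _+_ lower (cong (a j l *_) b₀≡0) ⟩
  + 0 + a j l * + 0                                     ≡⟨ trans (ℤP.+-identityˡ _) (ℤP.*-zeroʳ (a j l)) ⟩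
  + 0                                                   ∎
  where
  open ≡-Reasoning
  lower : sumTo j (λ i → a i *ₚ b (j ∸ i)) l ≡ + 0
  lower = sumTo-vanishing j _ l λ i i<j →
    trans (cong (_* b (j ∸ i) l) (a≡0 i (ℕP.<-≤-trans i<j j≤s))) (ℤP.*-zeroˡ (b (j ∸ i) l))

*S-leading : ∀ s (a b : Series) l → (∀ j → j < s → a j l ≡ + 0) → b 0 l ≡ + 0 →
  (a *S b) (suc s) l ≡ a s l * b 1 l
*S-leading s a b l a≡0 b₀≡0 = begin
  (a *S b) (suc s) l
    ≡⟨ *S-coeff-last (suc s) a b l ⟩
  sumTo s (λ i → a i *ₚ b (suc s ∸ i)) l + a s l * b (suc s ∸ s) l + a (suc s) l * b 0 l
    ≡⟨ cong₂ _+_ (cong₂ _+_ lower (cong (λ i → a s l * b i l) (ℕP.m+n∸n≡m 1 s)))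
                 (cong (a (suc s) l *_) b₀≡0) ⟩
  + 0 + a s l * b 1 l + a (suc s) l * + 0
    ≡⟨ identity (a s l * b 1 l) (a (suc s) l) ⟩
  a s l * b 1 l
    ∎
  where
  open ≡-Reasoning
  lower : sumTo s (λ i → a i *ₚ b (suc s ∸ i)) l ≡ + 0
  lower = sumTo-vanishing s _ l λ i i<s →
    trans (cong (_* b (suc s ∸ i) l) (a≡0 i i<s)) (ℤP.*-zeroˡ (b (suc s ∸ i) l))
  identity : ∀ x y → + 0 + x + y * + 0 ≡ x
  identity = solve-∀

module _ (g : Series) (l : ℕ) (g₀≡0 : g 0 l ≡ + 0) where

  ^S-vanishing : ∀ i j → j < i → (g ^S i) j l ≡ + 0
  ^S-vanishing (suc i) j (s≤s j≤i) = *S-vanishing i (g ^S i) g l (^S-vanishing i) g₀≡0 j j≤i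

  ^S-coeff-diagonal : ∀ i → (g ^S i) i l ≡ g 1 l ^ i
  ^S-coeff-diagonal zero    = refl
  ^S-coeff-diagonal (suc i) = begin
    ((g ^S i) *S g) (suc i) l   ≡⟨ *S-leading i (g ^S i) g l (^S-vanishing i) g₀≡0 ⟩
    (g ^S i) i l * g 1 l        ≡⟨ cong (_* g 1 l) (^S-coeff-diagonal i) ⟩
    g 1 l ^ i * g 1 l           ≡⟨ ℤP.*-comm (g 1 l ^ i) (g 1 l) ⟩
    g 1 l ^ suc i               ∎
    where open ≡-Reasoning

compose-coeff₀ : ∀ f g l → compose f g 0 l ≡ f 0 l
compose-coeff₀ f g l = trans (ℤP.+-identityˡ _) (ℤP.*-identityʳ (f 0 l))

1+X : Series
1+X = oneS +S Xs

1+X^S-coeff₀ : ∀ i l → (1+X ^S i) 0 l ≡ + 1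
1+X^S-coeff₀ zero    l = refl
1+X^S-coeff₀ (suc i) l rewrite 1+X^S-coeff₀ i l = refl

1+X^S-coeff₁ : ∀ i l → (1+X ^S i) 1 l ≡ + i
1+X^S-coeff₁ zero    l = refl
1+X^S-coeff₁ (suc i) l rewrite 1+X^S-coeff₀ i l | 1+X^S-coeff₁ i l =
  cong (λ x → + 1 + x) (ℤP.*-identityʳ (+ i))

G : ℕ → Series
G p = (1+X ^S p) -S oneS

G-coeff₀ : ∀ p l → G p 0 l ≡ + 0
G-coeff₀ p l rewrite 1+X^S-coeff₀ p l = refl

G-coeff₁ : ∀ p l → G p 1 l ≡ + p
G-coeff₁ p l rewrite 1+X^S-coeff₁ p l = ℤP.+-identityʳ (+ p)

G^S-coeff-diagonal : ∀ p l i → (G p ^S i) i l ≡ (+ p) ^ i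
G^S-coeff-diagonal p l i = trans (^S-coeff-diagonal (G p) l (G-coeff₀ p l) i) (cong (_^ i) (G-coeff₁ p l))

Ψ-diagonal : ℕ → ℕ → ℤ
Ψ-diagonal p k = (+ p) ^ k * (+ p) ^ k - + 1

geometricSum : ℤ → ℕ → ℤ
geometricSum q zero    = + 0
geometricSum q (suc m) = + 1 + q * geometricSum q m

geometricSum-telescopes : ∀ q m → (q - + 1) * geometricSum q m ≡ q ^ m - + 1
geometricSum-telescopes q zero    = ℤP.*-zeroʳ (q - + 1)
geometricSum-telescopes q (suc m) = begin
  (q - + 1) * (+ 1 + q * geometricSum q m)
    ≡⟨ identity₁ q (geometricSum q m) ⟩
  q - + 1 + q * ((q - + 1) * geometricSum q m)
    ≡⟨ cong (λ x → q - + 1 + q * x) (geometricSum-telescopes q m) ⟩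
  q - + 1 + q * (q ^ m - + 1)
    ≡⟨ identity₂ q (q ^ m) ⟩
  q * q ^ m - + 1
    ∎
  where
  open ≡-Reasoning
  identity₁ : ∀ q s → (q - + 1) * (+ 1 + q * s) ≡ q - + 1 + q * ((q - + 1) * s)
  identity₁ = solve-∀
  identity₂ : ∀ q x → q - + 1 + q * (x - + 1) ≡ q * x - + 1
  identity₂ = solve-∀

^-distrib-pos-* : ∀ p w m → (+ p * w) ^ m ≡ + (p ℕ.^ m) * w ^ m
^-distrib-pos-* p w zero    = refl
^-distrib-pos-* p w (suc m) = begin
  (+ p * w) * (+ p * w) ^ m          ≡⟨ cong ((+ p * w) *_) (^-distrib-pos-* p w m) ⟩
  (+ p * w) * (+ (p ℕ.^ m) * w ^ m)  ≡⟨ identity (+ p) w (+ (p ℕ.^ m)) (w ^ m) ⟩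
  (+ p * + (p ℕ.^ m)) * (w * w ^ m)  ≡⟨ cong (_* (w * w ^ m)) (sym (ℤP.pos-* p (p ℕ.^ m))) ⟩
  + (p ℕ.^ suc m) * w ^ suc m        ∎
  where
  open ≡-Reasoning
  identity : ∀ a w b v → (a * w) * (b * v) ≡ (a * b) * (w * v)
  identity = solve-∀

[p*w]^m≈0 : ∀ p w m → Congruence._≈_ (+ (p ℕ.^ m)) ((+ p * w) ^ m) (+ 0)
[p*w]^m≈0 p w m = (w ^ m) Congruence., (begin
  (+ p * w) ^ m              ≡⟨ ^-distrib-pos-* p w m ⟩
  + (p ℕ.^ m) * w ^ m        ≡⟨ ℤP.*-comm (+ (p ℕ.^ m)) (w ^ m) ⟩
  w ^ m * + (p ℕ.^ m)        ≡⟨ sym (ℤP.+-identityˡ _) ⟩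
  + 0 + w ^ m * + (p ℕ.^ m)  ∎)
  where open ≡-Reasoning

Ψ-diagonal-inverse : ℕ → ℕ → ℕ → ℤ
Ψ-diagonal-inverse p k m = - geometricSum ((+ p) ^ k * (+ p) ^ k) m

-- For k ≥ 1, q = p^{2k} is divisible by p, so q^m ≡ 0 modulo p^m and (q - 1)·Σ_{i<m} q^i = q^m - 1 ≡ -1.
Ψ-diagonal-invertible : ∀ p k m →
  Congruence._≈_ (+ (p ℕ.^ m)) (Ψ-diagonal p (suc k) * Ψ-diagonal-inverse p (suc k) m) (+ 1)
Ψ-diagonal-invertible p k m = begin
  (q - + 1) * - geometricSum q m     ≡⟨ sym (ℤP.neg-distribʳ-* (q - + 1) (geometricSum q m)) ⟩
  - ((q - + 1) * geometricSum q m)   ≡⟨ cong -_ (geometricSum-telescopes q m) ⟩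
  - (q ^ m - + 1)                    ≈⟨ -‿cong (+-cong q^m≈0 (≈-refl { - + 1})) ⟩
  - (+ 0 - + 1)                      ≡⟨⟩
  + 1                                ∎
  where
  open Congruence (+ (p ℕ.^ m))
  open ≈-Reasoning
  w = (+ p) ^ k * (+ p) ^ suc k
  q = (+ p) ^ suc k * (+ p) ^ suc k
  q≡p*w : q ≡ + p * w
  q≡p*w = ℤP.*-assoc (+ p) ((+ p) ^ k) ((+ p) ^ suc k)
  q^m≈0 : q ^ m ≈ + 0
  q^m≈0 = ≈-trans (≡⇒≈ (cong (_^ m) q≡p*w)) ([p*w]^m≈0 p w m)

module Agreement (m : ℤ) where

  open Congruence m

  -- Two levels l and l′ so that a series can also be compared with itself one p-adic level lower.
  record Agree (n : ℕ) (f : Series) (l : ℕ) (f′ : Series) (l′ : ℕ) : Set where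
    constructor agree
    field coeff : ∀ j → j < n → f j l ≈ f′ j l′
  open Agree public

  agree-suc : ∀ {n f l f′ l′} → Agree n f l f′ l′ → f n l ≈ f′ n l′ → Agree (suc n) f l f′ l′
  agree-suc below at-n = agree λ j j<1+n →
    [ coeff below j , (λ { refl → at-n }) ]′ (ℕP.m<1+n⇒m<n∨m≡n j<1+n)

  sumTo-cong : ∀ n {a b : ℕ → Raw} {l l′} → (∀ i → i < n → a i l ≈ b i l′) →
    sumTo n a l ≈ sumTo n b l′
  sumTo-cong zero    _   = ≈-refl
  sumTo-cong (suc n) a≈b = +-cong (sumTo-cong n (λ i i<n → a≈b i (ℕP.m<n⇒m<1+n i<n))) (a≈b n ℕP.≤-refl)

  oneS-agree : ∀ {n l l′} → Agree n oneS l oneS l′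
  oneS-agree = agree λ { zero _ → ≈-refl ; (suc _) _ → ≈-refl }

  Xs-agree : ∀ {n l l′} → Agree n Xs l Xs l′
  Xs-agree = agree λ { zero _ → ≈-refl ; (suc zero) _ → ≈-refl ; (suc (suc _)) _ → ≈-refl }

  +S-agree : ∀ {n a l a′ l′ b b′} → Agree n a l a′ l′ → Agree n b l b′ l′ →
    Agree n (a +S b) l (a′ +S b′) l′
  +S-agree ha hb = agree λ j j<n → +-cong (coeff ha j j<n) (coeff hb j j<n)

  -S-agree : ∀ {n a l a′ l′} → Agree n a l a′ l′ → Agree n (-S a) l (-S a′) l′
  -S-agree ha = agree λ j j<n → -‿cong (coeff ha j j<n)

  *S-agree : ∀ {n a l a′ l′ b b′} → Agree n a l a′ l′ → Agree n b l b′ l′ →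
    Agree n (a *S b) l (a′ *S b′) l′
  *S-agree ha hb = agree λ j j<n → sumTo-cong (suc j) λ i i≤j →
    *-cong (coeff ha i (ℕP.<-≤-trans i≤j j<n)) (coeff hb (j ∸ i) (ℕP.≤-<-trans (ℕP.m∸n≤m j i) j<n))

  ^S-agree : ∀ {n a l a′ l′} → Agree n a l a′ l′ → ∀ i → Agree n (a ^S i) l (a′ ^S i) l′
  ^S-agree ha zero    = oneS-agree
  ^S-agree ha (suc i) = *S-agree (^S-agree ha i) ha

  compose-agree : ∀ {n f l f′ l′ g g′} → Agree n f l f′ l′ → Agree n g l g′ l′ →
    Agree n (compose f g) l (compose f′ g′) l′
  compose-agree hf hg = agree λ j j<n → sumTo-cong (suc j) λ i i≤j →
    *-cong (coeff hf i (ℕP.<-≤-trans i≤j j<n)) (coeff (^S-agree hg i) j j<n)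

  *S-coeff-diff : ∀ n {a l a′ l′ b b′} → Agree (suc n) a l a′ l′ → Agree (suc n) b l b′ l′ →
    (a *S b) (suc n) l ≈ (a′ *S b′) (suc n) l′
                         + (a 0 l * (b (suc n) l - b′ (suc n) l′) + (a (suc n) l - a′ (suc n) l′) * b 0 l)
  *S-coeff-diff n {a} {l} {a′} {l′} {b} {b′} ha hb = begin
    (a *S b) (suc n) l
      ≡⟨ *S-coeff-suc n a b l ⟩
    a₀ * bₙ + inner a b l + aₙ * b₀
      ≡⟨ identity a₀ bₙ (inner a b l) aₙ b₀ bₙ′ aₙ′ ⟩
    a₀ * bₙ′ + inner a b l + aₙ′ * b₀ + D
      ≈⟨ +-cong (+-cong (+-cong (*-cong (coeff ha 0 (s≤s z≤n)) (≈-refl {bₙ′})) inner≈)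
                        (*-cong (≈-refl {aₙ′}) (coeff hb 0 (s≤s z≤n))))
                (≈-refl {D}) ⟩
    a′ 0 l′ * bₙ′ + inner a′ b′ l′ + aₙ′ * b′ 0 l′ + D
      ≡⟨ cong (_+ D) (sym (*S-coeff-suc n a′ b′ l′)) ⟩
    (a′ *S b′) (suc n) l′ + D
      ∎
    where
    open ≈-Reasoning
    a₀ = a 0 l
    b₀ = b 0 l
    aₙ = a (suc n) l
    bₙ = b (suc n) l
    aₙ′ = a′ (suc n) l′
    bₙ′ = b′ (suc n) l′
    D = a₀ * (bₙ - bₙ′) + (aₙ - aₙ′) * b₀
    inner : Series → Series → ℕ → ℤ
    inner a b = sumTo n (λ i → a (suc i) *ₚ b (n ∸ i))
    inner≈ : inner a b l ≈ inner a′ b′ l′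
    inner≈ = sumTo-cong n λ i i<n →
      *-cong (coeff ha (suc i) (s≤s i<n)) (coeff hb (n ∸ i) (s≤s (ℕP.m∸n≤m n i)))
    identity : ∀ a₀ bₙ c aₙ b₀ bₙ′ aₙ′ →
      a₀ * bₙ + c + aₙ * b₀
        ≡ a₀ * bₙ′ + c + aₙ′ * b₀ + (a₀ * (bₙ - bₙ′) + (aₙ - aₙ′) * b₀)
    identity = solve-∀

  ^S-suc-coeff₀ : ∀ {e l} i → e 0 l ≈ + 0 → (e ^S suc i) 0 l ≈ + 0
  ^S-suc-coeff₀ {e} {l} i e₀≈0 = begin
    (e ^S suc i) 0 l        ≡⟨ *S-coeff₀ (e ^S i) e l ⟩
    (e ^S i) 0 l * e 0 l    ≈⟨ *-cong (≈-refl {(e ^S i) 0 l}) e₀≈0 ⟩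
    (e ^S i) 0 l * + 0      ≡⟨ ℤP.*-zeroʳ ((e ^S i) 0 l) ⟩
    + 0                     ∎
    where open ≈-Reasoning

  ^S[2+i]-coeff-agree : ∀ n {e l e′ l′} → Agree (suc n) e l e′ l′ → e 0 l ≈ + 0 →
    ∀ i → (e ^S suc (suc i)) (suc n) l ≈ (e′ ^S suc (suc i)) (suc n) l′
  ^S[2+i]-coeff-agree n {e} {l} {e′} {l′} he e₀≈0 i = begin
    (e ^S suc (suc i)) (suc n) l
      ≈⟨ *S-coeff-diff n (^S-agree he (suc i)) he ⟩
    x′ + ((e ^S suc i) 0 l * d + y * e 0 l)
      ≈⟨ +-cong (≈-refl {x′})
                (+-cong (*-cong (^S-suc-coeff₀ i e₀≈0) (≈-refl {d})) (*-cong (≈-refl {y}) e₀≈0)) ⟩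
    x′ + (+ 0 * d + y * + 0)
      ≡⟨ identity x′ d y ⟩
    x′
      ∎
    where
    open ≈-Reasoning
    x′ = (e′ ^S suc (suc i)) (suc n) l′
    d = e (suc n) l - e′ (suc n) l′
    y = (e ^S suc i) (suc n) l - (e′ ^S suc i) (suc n) l′
    identity : ∀ x d y → x + (+ 0 * d + y * + 0) ≡ x
    identity = solve-∀

  -- With e = 1 - f, 1/f = Σ_k e^k. As e has no constant term, e_{n+1} enters the X^{n+1}-coefficient
  -- only through e^1; the powers e^k with k ≥ 2 see only coefficients of e below n + 1.
  inv-coeff-diff : ∀ n {f l f′ l′} → Agree (suc n) f l f′ l′ → f 0 l ≈ + 1 →
    inv f (suc n) l ≈ inv f′ (suc n) l′ - (f (suc n) l - f′ (suc n) l′)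
  inv-coeff-diff n {f} {l} {f′} {l′} hf f₀≈1 = begin
    inv f (suc n) l
      ≡⟨ expand f l ⟩
    + 1 * + 0 + (+ 1 * first f l + rest f l)
      ≈⟨ +-cong (≈-refl {+ 1 * + 0})
                (+-cong (*-cong (≈-refl {+ 1}) (*S-coeff-diff n oneS-agree he)) rest≈) ⟩
    + 1 * + 0 + (+ 1 * (first f′ l′ + (+ 1 * (+ 0 + - fₙ - (+ 0 + - fₙ′)) + (+ 0 - + 0) * (+ 1 + - f 0 l)))
                 + rest f′ l′)
      ≡⟨ identity (first f′ l′) (rest f′ l′) fₙ fₙ′ (+ 1 + - f 0 l) ⟩
    + 1 * + 0 + (+ 1 * first f′ l′ + rest f′ l′) - (fₙ - fₙ′)
      ≡⟨ cong (_- (fₙ - fₙ′)) (sym (expand f′ l′)) ⟩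
    inv f′ (suc n) l′ - (fₙ - fₙ′)
      ∎
    where
    open ≈-Reasoning
    fₙ = f (suc n) l
    fₙ′ = f′ (suc n) l′
    he : Agree (suc n) (oneS -S f) l (oneS -S f′) l′
    he = +S-agree oneS-agree (-S-agree hf)
    e₀≈0 : (oneS -S f) 0 l ≈ + 0
    e₀≈0 = +-cong (≈-refl {+ 1}) (-‿cong f₀≈1)
    first : Series → ℕ → ℤ
    first f = ((oneS -S f) ^S 1) (suc n)
    rest : Series → ℕ → ℤ
    rest f = sumTo n (λ i → ι (+ 1) *ₚ ((oneS -S f) ^S suc (suc i)) (suc n))
    expand : ∀ f l → inv f (suc n) l ≡ + 1 * + 0 + (+ 1 * first f l + rest f l)
    expand f l = trans (sumTo-unfoldˡ (suc n) _ l) (cong (λ x → + 1 * + 0 + x) (sumTo-unfoldˡ n _ l))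
    rest≈ : rest f l ≈ rest f′ l′
    rest≈ = sumTo-cong n λ i _ → *-cong (≈-refl {+ 1}) (^S[2+i]-coeff-agree n he e₀≈0 i)
    identity : ∀ x r y y′ c →
      + 1 * + 0 + (+ 1 * (x + (+ 1 * (+ 0 + - y - (+ 0 + - y′)) + (+ 0 - + 0) * c)) + r)
        ≡ + 1 * + 0 + (+ 1 * x + r) - (y - y′)
    identity = solve-∀

  module _ (p : ℕ) where

    G-agree : ∀ {n l l′} → Agree n (G p) l (G p) l′
    G-agree = +S-agree (^S-agree (+S-agree oneS-agree Xs-agree) p) (-S-agree oneS-agree)

    φ-agree : ∀ {n f l f′ l′} → Agree n f l f′ l′ → Agree n (φ p f) l (φ p f′) l′
    φ-agree hf = compose-agree hf G-agree

    inv-agree : ∀ {n f l f′ l′} → Agree n f l f′ l′ → Agree n (inv f) l (inv f′) l′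
    inv-agree {n} {l = l} {l′ = l′} hf = compose-agree ones (+S-agree oneS-agree (-S-agree hf))
      where
      ones : Agree n (λ _ → ι (+ 1)) l (λ _ → ι (+ 1)) l′
      ones = agree λ _ _ → ≈-refl

    Ψ-agree : ∀ {n f l f′ l′} → Agree n f l f′ l′ → Agree n (Ψ p f) l (Ψ p f′) l′
    Ψ-agree hf = *S-agree (φ-agree (φ-agree hf)) (inv-agree hf)

    φ-coeff-diff : ∀ k {f l f′ l′} → Agree k f l f′ l′ →
      φ p f k l ≈ φ p f′ k l′ + (f k l - f′ k l′) * (+ p) ^ k
    φ-coeff-diff k {f} {l} {f′} {l′} hf = begin
      lower f l + f k l * (G p ^S k) k l
        ≡⟨ cong (λ x → lower f l + f k l * x) (G^S-coeff-diagonal p l k) ⟩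
      lower f l + f k l * P
        ≡⟨ identity (lower f l) (f k l) (f′ k l′) P ⟩
      lower f l + f′ k l′ * P + (f k l - f′ k l′) * P
        ≈⟨ +-cong (+-cong lower≈ (≈-refl {f′ k l′ * P})) (≈-refl {(f k l - f′ k l′) * P}) ⟩
      lower f′ l′ + f′ k l′ * P + (f k l - f′ k l′) * P
        ≡⟨ cong (λ x → lower f′ l′ + f′ k l′ * x + (f k l - f′ k l′) * P)
                (sym (G^S-coeff-diagonal p l′ k)) ⟩
      φ p f′ k l′ + (f k l - f′ k l′) * P
        ∎
      where
      open ≈-Reasoning
      P = (+ p) ^ k
      lower : Series → ℕ → ℤ
      lower f = sumTo k (λ i → f i *ₚ (G p ^S i) k)
      lower≈ : lower f l ≈ lower f′ l′
      lower≈ = sumTo-cong k λ i i<k →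
        *-cong (coeff hf i i<k) (coeff (^S-agree (G-agree {suc k}) i) k ℕP.≤-refl)
      identity : ∀ s x x′ P → s + x * P ≡ s + x′ * P + (x - x′) * P
      identity = solve-∀

    φ²-coeff-diff : ∀ k {f l f′ l′} → Agree k f l f′ l′ →
      φ p (φ p f) k l ≈ φ p (φ p f′) k l′ + (f k l - f′ k l′) * (+ p) ^ k * (+ p) ^ k
    φ²-coeff-diff k {f} {l} {f′} {l′} hf =
      ≈-trans (φ-coeff-diff k (φ-agree hf))
              (+-cong (≈-refl {φ p (φ p f′) k l′})
                      (*-cong (x≈y+d⇒x-y≈d (φ-coeff-diff k hf)) (≈-refl {(+ p) ^ k})))

    Ψ-coeff₀ : ∀ {f l} → f 0 l ≈ + 1 → Ψ p f 0 l ≈ + 1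
    Ψ-coeff₀ {f} {l} f₀≈1 = begin
      Ψ p f 0 l                 ≡⟨ *S-coeff₀ (φ p (φ p f)) (inv f) l ⟩
      φ p (φ p f) 0 l * inv f 0 l
        ≡⟨ cong₂ _*_ (trans (compose-coeff₀ (φ p f) (G p) l) (compose-coeff₀ f (G p) l))
                     (compose-coeff₀ (λ _ → ι (+ 1)) (oneS -S f) l) ⟩
      f 0 l * + 1               ≈⟨ *-cong f₀≈1 (≈-refl {+ 1}) ⟩
      + 1                       ∎
      where open ≈-Reasoning

    Ψ-coeff-diff : ∀ n {f l f′ l′} → Agree (suc n) f l f′ l′ → f 0 l ≈ + 1 →
      Ψ p f (suc n) l ≈ Ψ p f′ (suc n) l′ + Ψ-diagonal p (suc n) * (f (suc n) l - f′ (suc n) l′)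
    Ψ-coeff-diff n {f} {l} {f′} {l′} hf f₀≈1 = begin
      Ψ p f (suc n) l
        ≈⟨ *S-coeff-diff n (φ-agree (φ-agree hf)) (inv-agree hf) ⟩
      y + (φ p (φ p f) 0 l * (inv f (suc n) l - inv f′ (suc n) l′)
           + (φ p (φ p f) (suc n) l - φ p (φ p f′) (suc n) l′) * inv f 0 l)
        ≈⟨ +-cong (≈-refl {y})
                  (+-cong (*-cong φ²f₀≈1 (x≈y+d⇒x-y≈d (inv-coeff-diff n hf f₀≈1)))
                          (*-cong (x≈y+d⇒x-y≈d (φ²-coeff-diff (suc n) hf))
                                  (≡⇒≈ (compose-coeff₀ (λ _ → ι (+ 1)) (oneS -S f) l)))) ⟩
      y + (+ 1 * - d + d * P * P * + 1)
        ≡⟨ cong (λ x → y + x) (identity d P) ⟩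
      y + Ψ-diagonal p (suc n) * d
        ∎
      where
      open ≈-Reasoning
      y = Ψ p f′ (suc n) l′
      d = f (suc n) l - f′ (suc n) l′
      P = (+ p) ^ suc n
      φ²f₀≈1 : φ p (φ p f) 0 l ≈ + 1
      φ²f₀≈1 =
        ≈-trans (≡⇒≈ (trans (compose-coeff₀ (φ p f) (G p) l) (compose-coeff₀ f (G p) l))) f₀≈1
      identity : ∀ d P → + 1 * - d + d * P * P * + 1 ≡ (P * P - + 1) * d
      identity = solve-∀

module _ (p m : ℕ) where

  open Congruence (+ (p ℕ.^ m))
  open Agreement (+ (p ℕ.^ m))

  agree-suc-from-Ψ : ∀ n {f l f′ l′} → Agree (suc n) f l f′ l′ → f 0 l ≈ + 1 →
    Ψ p f (suc n) l ≈ Ψ p f′ (suc n) l′ → Agree (suc (suc n)) f l f′ l′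
  agree-suc-from-Ψ n {f} {l} {f′} {l′} below f₀≈1 Ψ≈ =
    agree-suc below (x-y≈0⇒x≈y (unit-cancel {c} {u} (Ψ-diagonal-invertible p n m) c*d≈0))
    where
    c = Ψ-diagonal p (suc n)
    u = Ψ-diagonal-inverse p (suc n) m
    c*d≈0 : c * (f (suc n) l - f′ (suc n) l′) ≈ + 0
    c*d≈0 = ≈-trans (≈-sym (x≈y+d⇒x-y≈d (Ψ-coeff-diff p n below f₀≈1))) (x≈y⇒x-y≈0 Ψ≈)

  Ψ-coeff-injective : ∀ {f l f′ l′} → f 0 l ≈ + 1 → f′ 0 l′ ≈ + 1 →
    (∀ k → Ψ p f k l ≈ Ψ p f′ k l′) → ∀ n → Agree n f l f′ l′
  Ψ-coeff-injective f₀≈1 f′₀≈1 Ψ≈ zero          = agree λ _ ()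
  Ψ-coeff-injective f₀≈1 f′₀≈1 Ψ≈ (suc zero)    =
    agree-suc (agree λ _ ()) (≈-trans f₀≈1 (≈-sym f′₀≈1))
  Ψ-coeff-injective f₀≈1 f′₀≈1 Ψ≈ (suc (suc n)) =
    agree-suc-from-Ψ n (Ψ-coeff-injective f₀≈1 f′₀≈1 Ψ≈ (suc n)) f₀≈1 (Ψ≈ (suc n))

setCoeff : Series → ℕ → Raw → Series
setCoeff f k c j with j ℕ.≟ k
... | yes _ = c
... | no  _ = f j

setCoeff-≡ : ∀ f k c → setCoeff f k c k ≡ c
setCoeff-≡ f k c with k ℕ.≟ k
... | yes _   = refl
... | no  k≢k = ⊥-elim (k≢k refl)

setCoeff-≢ : ∀ f k c {j} → j ≢ k → setCoeff f k c j ≡ f j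
setCoeff-≢ f k c {j} j≢k with j ℕ.≟ k
... | yes j≡k = ⊥-elim (j≢k j≡k)
... | no  _   = refl

module Preimage (p : ℕ) (g : Series) (g∈ : In1+XZp[[X]] p g) where

  -- approximation k is a polynomial of degree ≤ k whose top coefficient is chosen, separately at
  -- every level m, so that the X^k-coefficient of Ψ matches that of g.
  correction : Series → ℕ → Raw
  correction f k m = Ψ-diagonal-inverse p (suc k) m * (g (suc k) m - Ψ p f (suc k) m)

  approximation : ℕ → Series
  approximation zero    = oneS
  approximation (suc k) = setCoeff (approximation k) (suc k) (correction (approximation k) k)

  approximation-suc-≢ : ∀ k {j} → j ≢ suc k → approximation (suc k) j ≡ approximation k j
  approximation-suc-≢ k = setCoeff-≢ (approximation k) (suc k) (correction (approximation k) k)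

  approximation-coeff₀ : ∀ k → approximation k 0 ≡ ι (+ 1)
  approximation-coeff₀ zero    = refl
  approximation-coeff₀ (suc k) = trans (approximation-suc-≢ k λ ()) (approximation-coeff₀ k)

  approximation-above : ∀ k j → k < j → approximation k j ≡ ι (+ 0)
  approximation-above zero    (suc j) _   = refl
  approximation-above (suc k) j       k<j =
    trans (approximation-suc-≢ k (ℕP.>⇒≢ k<j)) (approximation-above k j (ℕP.<-trans (ℕP.n<1+n k) k<j))

  approximation-stable : ∀ k j → j ≤ k → approximation k j ≡ approximation j j
  approximation-stable zero    zero _   = refl
  approximation-stable (suc k) j    j≤k with ℕP.m≤n⇒m<n∨m≡n j≤k
  ... | inj₂ refl      = refl
  ... | inj₁ (s≤s j≤k) =
    trans (approximation-suc-≢ k (ℕP.<⇒≢ (s≤s j≤k))) (approximation-stable k j j≤k)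

  preimage : Series
  preimage j = approximation j j

  module _ (m : ℕ) where

    open Congruence (+ (p ℕ.^ m))
    open Agreement (+ (p ℕ.^ m))

    approximation-step : ∀ k → Agree (suc k) (approximation (suc k)) m (approximation k) m
    approximation-step k = agree λ j j<1+k →
      ≡⇒≈ (cong (λ c → c m) (approximation-suc-≢ k (ℕP.<⇒≢ j<1+k)))

    preimage-agree : ∀ k → Agree (suc k) preimage m (approximation k) m
    preimage-agree k = agree λ j j<1+k →
      ≡⇒≈ (cong (λ c → c m) (sym (approximation-stable k j (ℕP.≤-pred j<1+k))))

    Ψ-approximation : ∀ k → Ψ p (approximation k) k m ≈ g k m
    Ψ-approximation zero    = ≈-sym (≡[mod]⇒≈ (proj₂ g∈ m))
    Ψ-approximation (suc k) = begin
      Ψ p (approximation (suc k)) (suc k) m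
        ≈⟨ Ψ-coeff-diff p k (approximation-step k)
                        (≡⇒≈ (cong (λ c → c m) (approximation-coeff₀ (suc k)))) ⟩
      x + c * (approximation (suc k) (suc k) m - approximation k (suc k) m)
        ≡⟨ cong₂ (λ a b → x + c * (a - b))
                 (cong (λ c → c m) (setCoeff-≡ (approximation k) (suc k) (correction (approximation k) k)))
                 (cong (λ c → c m) (approximation-above k (suc k) ℕP.≤-refl)) ⟩
      x + c * (u * (g (suc k) m - x) - + 0)
        ≡⟨ cong (λ y → x + c * y) (ℤP.+-identityʳ _) ⟩
      x + c * (u * (g (suc k) m - x))
        ≈⟨ unit-correction {c} {u} {x} {g (suc k) m} (Ψ-diagonal-invertible p k m) ⟩
      g (suc k) m
        ∎
      where
      open ≈-Reasoning
      x = Ψ p (approximation k) (suc k) m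
      c = Ψ-diagonal p (suc k)
      u = Ψ-diagonal-inverse p (suc k) m

    Ψ-preimage : ∀ k → Ψ p preimage k m ≈ g k m
    Ψ-preimage k = ≈-trans (coeff (Ψ-agree p (preimage-agree k)) k ℕP.≤-refl) (Ψ-approximation k)

  preimage-∈ : In1+XZp[[X]] p preimage
  preimage-∈ = series , λ n → ≈⇒≡[mod] {p ℕ.^ n} {+ 1} (Congruence.≈-refl (+ (p ℕ.^ n)))
    where
    -- Comparing the preimage with itself one level lower: both solve Ψ(f) ≡ g modulo p^m.
    series : IsSeries p preimage
    series k m = ≈⇒≡[mod] (coeff (Ψ-coeff-injective p m ≈-refl ≈-refl Ψ-levels (suc k)) k ℕP.≤-refl)
      where
      open Congruence (+ (p ℕ.^ m))
      open Agreement (+ (p ℕ.^ m))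
      Ψ-levels : ∀ k → Ψ p preimage k (suc m) ≈ Ψ p preimage k m
      Ψ-levels k = ≈-trans (≈-mod-suc p m (Ψ-preimage (suc m) k))
                           (≈-trans (≡[mod]⇒≈ (proj₁ g∈ k m)) (≈-sym (Ψ-preimage m k)))

Ψ-preserves-1+XZp[[X]] : ∀ p f → In1+XZp[[X]] p f → In1+XZp[[X]] p (Ψ p f)
Ψ-preserves-1+XZp[[X]] p f (f-series , f₀≡1) =
  Ψf-series , λ n → ≈⇒≡[mod] (Agreement.Ψ-coeff₀ (+ (p ℕ.^ n)) p {f} (≡[mod]⇒≈ (f₀≡1 n)))
  where
  Ψf-series : IsSeries p (Ψ p f)
  Ψf-series k m = ≈⇒≡[mod] (coeff (Ψ-agree p levels) k ℕP.≤-refl)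
    where
    open Agreement (+ (p ℕ.^ m))
    levels : Agree (suc k) f (suc m) f m
    levels = agree λ j _ → ≡[mod]⇒≈ (f-series j m)

Ψ-injective : ∀ p f f′ → In1+XZp[[X]] p f → In1+XZp[[X]] p f′ →
  Ψ p f ≋[ p ] Ψ p f′ → f ≋[ p ] f′
Ψ-injective p f f′ (_ , f₀≡1) (_ , f′₀≡1) Ψf≋Ψf′ k n =
  ≈⇒≡[mod] (Agreement.coeff (Ψ-coeff-injective p n (≡[mod]⇒≈ (f₀≡1 n)) (≡[mod]⇒≈ (f′₀≡1 n))
                                                 (λ j → ≡[mod]⇒≈ (Ψf≋Ψf′ j n)) (suc k))
                            k ℕP.≤-refl)

Ψ-surjective : ∀ p g → In1+XZp[[X]] p g → ∃[ f ] (In1+XZp[[X]] p f × Ψ p f ≋[ p ] g)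
Ψ-surjective p g g∈ = preimage , preimage-∈ , λ k n → ≈⇒≡[mod] (Ψ-preimage n k)
  where open Preimage p g g∈

lemma3p2 : (p : ℕ) → Prime p →
    ((f : Series) → In1+XZp[[X]] p f → In1+XZp[[X]] p (Ψ p f))
    × ((f f′ : Series) → In1+XZp[[X]] p f → In1+XZp[[X]] p f′ →
        Ψ p f ≋[ p ] Ψ p f′ → f ≋[ p ] f′)
    × ((g : Series) → In1+XZp[[X]] p g →
        ∃[ f ] (In1+XZp[[X]] p f × Ψ p f ≋[ p ] g))
lemma3p2 p _ = Ψ-preserves-1+XZp[[X]] p , Ψ-injective p , Ψ-surjective p
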